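{- For every integer \(r\ge 1\), let \(K_{3,3}^{\sqcup r}\) be the disjoint union of \(r\) copies of \(K_{3,3}\). Then \[ \operatorname{pf}\bigl(K_{3,3}^{\sqcup r}\bigr)\ge \left\lceil\left(\tfrac83\right)^r\right\rceil . \]
   Context: For a finite simple graph \(G\) on \(2n\) vertices, assign an independent variable \(x_e\) to each edge \(e\); the perfect-matching polynomial is \(\mathrm{PM}(G)=\sum_{M}\prod_{e\in M}x_e\) over all perfect matchings \(M\). Fix an ordering of the vertices. For an orientation \(D\) of \(G\), the weighted skew-adjacency matrix \(A_D\) has \((A_D)_{ij}=x_{ij}\) if \(ij\) is an edge oriented from \(i\) to \(j\), \(-x_{ij}\) if oriented from \(j\) to \(i\), and \(0\) if \(ij\) is not an edge; \(\mathrm{Pf}(A_D)\) is its Pfaffian. \(G\) is \(k\)-Pfaffian if there exist orientations \(D_1,\dots,D_k\) and reals \(c_1,\dots,c_k\) with \(\mathrm{PM}(G)=\sum_{i=1}^k c_i\,\mathrm{Pf}(A_{D_i})\) as polynomials; the Pfaffian number \(\operatorname{pf}(G)\) is the least positive integer \(k\) such that \(G\) is \(k\)-Pfaffian.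
   Formalization: The coefficients $c_1,\dots,c_k$ in a k-Pfaffian representation of PM(G) range only over the rationals instead of the reals. -}

module Defs where

open import Data.Nat as ℕ using (ℕ; zero; suc; _<ᵇ_; _≡ᵇ_)
open import Data.Fin using (Fin; zero; suc; toℕ; punchIn; splitAt)
open import Data.Bool using (Bool; true; false; if_then_else_; _∧_; not; _xor_)
open import Data.Sum using (_⊎_; inj₁; inj₂)
open import Data.Product using (Σ)
open import Data.List using (List; []; _∷_; map; concatMap; allFin; foldr)
open import Data.Integer as ℤ using (ℤ; +_)
open import Data.Rational using (ℚ; 0ℚ; 1ℚ; _+_; _*_; -_; _/_; ceiling)
open import Relation.Binary.PropositionalEquality using (_≡_; refl)

-- Finite simple graphs on the vertex set Fin n (the fixed vertex ordering
-- is the order of Fin n).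

record Graph (n : ℕ) : Set where
  field
    adj    : Fin n → Fin n → Bool
    sym    : ∀ i j → adj i j ≡ adj j i
    irrefl : ∀ i → adj i i ≡ false
open Graph public

ltF : ∀ {n} → Fin n → Fin n → Bool
ltF i j = toℕ i <ᵇ toℕ j

eqF : ∀ {n} → Fin n → Fin n → Bool
eqF i j = toℕ i ≡ᵇ toℕ j

sumFin : ∀ {n} → (Fin n → ℚ) → ℚ
sumFin {zero}  f = 0ℚ
sumFin {suc n} f = f zero + sumFin (λ i → f (suc i))

prodFin : ∀ {n} → (Fin n → ℚ) → ℚ
prodFin {zero}  f = 1ℚ
prodFin {suc n} f = f zero * prodFin (λ i → f (suc i))

allB : ∀ {n} → (Fin n → Bool) → Bool
allB {zero}  f = true
allB {suc n} f = f zero ∧ allB (λ i → f (suc i))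

consF : ∀ {m n} → Fin n → (Fin m → Fin n) → Fin (suc m) → Fin n
consF k f zero    = k
consF k f (suc i) = f i

allFuns : ∀ m n → List (Fin m → Fin n)
allFuns zero    n = (λ ()) ∷ []
allFuns (suc m) n = concatMap (λ k → map (consF k) (allFuns m n)) (allFin n)

-- Edge variables.  An assignment x gives a value to every pair; the
-- variable x_e of the edge e = {i,j} with i < j is x i j.

Assignment : ℕ → Set
Assignment n = Fin n → Fin n → ℚ

edgeVar : ∀ {n} → Assignment n → Fin n → Fin n → ℚ
edgeVar x i j = if ltF i j then x i j else x j i

-- Perfect matchings: a perfect matching M of G is encoded (uniquely) as
-- the fixed-point-free involution sending each vertex to its partner,
-- every pair {i, M i} being an edge of G.

isPerfectMatching : ∀ {n} → Graph n → (Fin n → Fin n) → Bool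
isPerfectMatching G M =
  allB (λ i → eqF (M (M i)) i ∧ (not (eqF (M i) i) ∧ adj G i (M i)))

matchingWeight : ∀ {n} → Assignment n → (Fin n → Fin n) → ℚ
matchingWeight x M = prodFin (λ i → if ltF i (M i) then edgeVar x i (M i) else 1ℚ)

PM : ∀ {n} → Graph n → Assignment n → ℚ
PM {n} G x = foldr _+_ 0ℚ (map (λ M → if isPerfectMatching G M then matchingWeight x M else 0ℚ)
                      (allFuns n n))

-- Orientations.  For i < j, D i j = true means the pair {i,j} is
-- oriented from i to j, false means from j to i.  (Values of D at
-- pairs with i ≥ j are irrelevant.)

Orientation : ℕ → Set
Orientation n = Fin n → Fin n → Bool

skewMatrix : ∀ {n} → Graph n → Orientation n → Assignment n → Fin n → Fin n → ℚ
skewMatrix G D x i j =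
  if adj G i j
  then (if ltF i j then (if D i j then edgeVar x i j else - edgeVar x i j)
                   else (if D j i then - edgeVar x i j else edgeVar x i j))
  else 0ℚ

sign : ℕ → ℚ
sign zero    = 1ℚ
sign (suc k) = - sign k

Pf : ∀ m → (Fin m → Fin m → ℚ) → ℚ
Pf zero          A = 1ℚ
Pf (suc zero)    A = 0ℚ
Pf (suc (suc m)) A =
  sumFin (λ (j : Fin (suc m)) →
    sign (toℕ j) * A zero (suc j)
      * Pf m (λ a b → A (suc (punchIn j a)) (suc (punchIn j b))))

-- k-Pfaffian graphs.  Polynomial identity over ℚ (an infinite field) is
-- expressed as equality of the evaluations at every assignment x.

IsKPfaffian : ∀ {n} → Graph n → ℕ → Set
IsKPfaffian {n} G k =
  Σ (Fin k → Orientation n) λ D →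
  Σ (Fin k → ℚ) λ c →
  ∀ (x : Assignment n) → PM G x ≡ sumFin (λ i → c i * Pf n (skewMatrix G (D i) x))

PfaffianNumberAtLeast : ∀ {n} → Graph n → ℤ → Set
PfaffianNumberAtLeast G m = ∀ (k : ℕ) → 1 ℕ.≤ k → IsKPfaffian G k → m ℤ.≤ + k

K33 : Graph 6
adj K33 i j = (toℕ i <ᵇ 3) xor (toℕ j <ᵇ 3)
sym K33 i j with toℕ i <ᵇ 3 | toℕ j <ᵇ 3
... | true  | true  = refl
... | true  | false = refl
... | false | true  = refl
... | false | false = refl
irrefl K33 i with toℕ i <ᵇ 3
... | true  = refl
... | false = refl

duAdj : ∀ {n m} → Graph n → Graph m → Fin (n ℕ.+ m) → Fin (n ℕ.+ m) → Bool
duAdj {n} G H i j with splitAt n i | splitAt n j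
... | inj₁ a | inj₁ b = adj G a b
... | inj₂ a | inj₂ b = adj H a b
... | inj₁ _ | inj₂ _ = false
... | inj₂ _ | inj₁ _ = false

_⊔ᴳ_ : ∀ {n m} → Graph n → Graph m → Graph (n ℕ.+ m)
adj (_⊔ᴳ_ G H) = duAdj G H
sym (_⊔ᴳ_ {n} G H) i j with splitAt n i | splitAt n j
... | inj₁ a | inj₁ b = sym G a b
... | inj₂ a | inj₂ b = sym H a b
... | inj₁ _ | inj₂ _ = refl
... | inj₂ _ | inj₁ _ = refl
irrefl (_⊔ᴳ_ {n} G H) i with splitAt n i
... | inj₁ a = irrefl G a
... | inj₂ a = irrefl H a

emptyGraph : Graph 0
adj emptyGraph ()
sym emptyGraph ()
irrefl emptyGraph ()

K33copies : (r : ℕ) → Graph (r ℕ.* 6)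
K33copies zero    = emptyGraph
K33copies (suc r) = K33 ⊔ᴳ K33copies r

_^ℚ_ : ℚ → ℕ → ℚ
q ^ℚ zero  = 1ℚ
q ^ℚ suc r = q * (q ^ℚ r)

{-# OPTIONS --safe #-}
module Submission where

-- Suppose PM(K₃,₃ ⊔ H) = Σᵢ cᵢ Pf(A_{Dᵢ}) with k terms.  Both PM and the Pfaffian are
-- multiplicative over disjoint unions, so fixing the variables of the K₃,₃ component at a point X
-- gives PM(K₃,₃)(X) · PM(H) = Σᵢ cᵢ Pf(A_{Dᵢ|K₃,₃})(X) · Pf(A_{Dᵢ|H}): a representation of a
-- multiple of PM(H) with coefficients cᵢ Pf(A_{Dᵢ|K₃,₃})(X).  There are 16 points X (sign patterns
-- on four edges) at which PM(K₃,₃) does not vanish, while for every orientation of K₃,₃ the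
-- Pfaffian vanishes at all but at most 6 of them (both checked by computation).  Summing the
-- bound for H over the 16 points counts each nonzero cᵢ at most 6 times, so by induction
-- 16^r ≤ 6^r · #{i : cᵢ ≠ 0} ≤ 6^r · k, that is, k ≥ (8/3)^r.

open import Defs
open import Data.Nat using (ℕ; _≤_)
open import Data.Integer using (+_)
open import Data.Rational using (_/_; ceiling)

open import Algebra.Bundles using (CommutativeRing)
import Algebra.Properties.CommutativeSemigroup as CommutativeSemigroupProperties
import Algebra.Properties.Semiring.Sum as SemiringSum
open import Data.Bool using (Bool; true; false; if_then_else_; _∧_; not; _xor_; T)
open import Data.Bool.Properties using (∧-assoc; ∧-zeroʳ; T-∧)
open import Data.Fin using (Fin; zero; suc; toℕ; punchIn; splitAt; join; _↑ˡ_; _↑ʳ_; #_)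
open import Data.Fin.Properties using (splitAt-↑ˡ; splitAt-↑ʳ; toℕ-↑ˡ; toℕ-↑ʳ; join-splitAt; all?)
import Data.Integer as ℤ
import Data.Integer.DivMod as ℤDivMod
import Data.Integer.Properties as ℤP
open import Data.List as List using (List; []; _∷_)
import Data.List.Properties as ListP
open import Data.Nat as ℕ using (zero; suc; _^_; _≡ᵇ_; _<ᵇ_; _≤ᵇ_; z≤n)
import Data.Nat.Coprimality as Coprimality
import Data.Nat.Properties as ℕP
open import Data.Product using (_,_; proj₁; proj₂)
open import Data.Rational as ℚ using (ℚ; mkℚ; 0ℚ; 1ℚ; _+_; _*_; -_; _≟_)
open import Data.Rational.Literals using (fromℤ)
import Data.Rational.Properties as ℚP
open import Algebra.Apartness.Properties.HeytingCommutativeRing ℚP.heytingCommutativeRing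
  using (x#0y#0→xy#0)
open import Data.Sum using (inj₁; inj₂)
open import Data.Sum.Properties using ([,]-map)
open import Data.Vec using (Vec; []; _∷_)
open import Data.Vec.Functional using (_++_)
open import Data.Vec.Functional.Properties using (lookup-++ˡ; lookup-++ʳ; ++-cong)
open import Function using (_∘_; id; Equivalence)
open import Relation.Binary.Core using (_Preserves_⟶_)
import Relation.Binary.PropositionalEquality as ≡
open ≡ using (_≡_; _≢_; _≗_; refl; cong; cong₂; trans; subst; subst₂; module ≡-Reasoning)
open import Relation.Nullary using (does; yes; no; ¬?)
open import Relation.Nullary.Decidable using (from-yes)

private
  variable
    A B : Set
    a b k m n : ℕ

module ℚΣ = SemiringSum (CommutativeRing.semiring ℚP.+-*-commutativeRing)
module ℕΣ = SemiringSum ℕP.+-*-semiring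
open ℚΣ using (sum; sum-cong-≗; *-distribˡ-sum; *-distribʳ-sum)

sumFin≡sum : (f : Fin n → ℚ) → sumFin f ≡ sum f
sumFin≡sum {zero}  f = refl
sumFin≡sum {suc n} f = cong (_+_ (f zero)) (sumFin≡sum (f ∘ suc))

sumFin-cong : {f g : Fin n → ℚ} → f ≗ g → sumFin f ≡ sumFin g
sumFin-cong {zero}  _   = refl
sumFin-cong {suc n} f≗g = cong₂ _+_ (f≗g zero) (sumFin-cong (f≗g ∘ suc))

sum-zero : {f : Fin n → ℚ} → (∀ i → f i ≡ 0ℚ) → sum f ≡ 0ℚ
sum-zero {n} f≗0 = trans (sum-cong-≗ f≗0) (ℚΣ.sum-replicate-zero n)

sum-↑ˡ-↑ʳ : ∀ a {b} (φ : Fin (a ℕ.+ b) → ℚ) → sum φ ≡ sum (φ ∘ (_↑ˡ b)) + sum (φ ∘ (a ↑ʳ_))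
sum-↑ˡ-↑ʳ zero    φ = ≡.sym (ℚP.+-identityˡ (sum φ))
sum-↑ˡ-↑ʳ (suc a) φ = trans (cong (_+_ (φ zero)) (sum-↑ˡ-↑ʳ a (φ ∘ suc))) (≡.sym (ℚP.+-assoc (φ zero) _ _))

-- A record, so that e and eᶜ can be inferred from a proof of Complementary e eᶜ.
record Complementary {M M′ N : ℕ} (e : Fin M → Fin N) (eᶜ : Fin M′ → Fin N) : Set where
  field
    sum-split : ∀ (φ : Fin N → ℚ) → sum φ ≡ sum (φ ∘ e) + sum (φ ∘ eᶜ)

↑ˡ-↑ʳ-complementary : ∀ a b → Complementary (_↑ˡ b) (a ↑ʳ_)
↑ˡ-↑ʳ-complementary a b = record { sum-split = sum-↑ˡ-↑ʳ a }

↑ʳ-↑ˡ-complementary : ∀ a b → Complementary (a ↑ʳ_) (_↑ˡ b)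
↑ʳ-↑ˡ-complementary a b = record
  { sum-split = λ φ → trans (sum-↑ˡ-↑ʳ a φ) (ℚP.+-comm (sum (φ ∘ (_↑ˡ b))) (sum (φ ∘ (a ↑ʳ_)))) }

listSum : List A → (A → ℚ) → ℚ
listSum xs h = List.foldr _+_ 0ℚ (List.map h xs)

listSum-++ : (xs ys : List A) (h : A → ℚ) → listSum (xs List.++ ys) h ≡ listSum xs h + listSum ys h
listSum-++ []       ys h = ≡.sym (ℚP.+-identityˡ _)
listSum-++ (x ∷ xs) ys h = trans (cong (_+_ (h x)) (listSum-++ xs ys h)) (≡.sym (ℚP.+-assoc (h x) _ _))

listSum-concatMap : (g : A → List B) (xs : List A) (h : B → ℚ) →
                    listSum (List.concatMap g xs) h ≡ listSum xs (λ x → listSum (g x) h)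
listSum-concatMap g []       h = refl
listSum-concatMap g (x ∷ xs) h =
  trans (listSum-++ (g x) _ h) (cong (_+_ (listSum (g x) h)) (listSum-concatMap g xs h))

listSum-map : (φ : A → B) (xs : List A) (h : B → ℚ) → listSum (List.map φ xs) h ≡ listSum xs (h ∘ φ)
listSum-map φ xs h = cong (List.foldr _+_ 0ℚ) (≡.sym (ListP.map-∘ xs))

listSum-tabulate : (f : Fin n → A) (h : A → ℚ) → listSum (List.tabulate f) h ≡ sum (h ∘ f)
listSum-tabulate {zero}  f h = refl
listSum-tabulate {suc n} f h = cong (_+_ (h (f zero))) (listSum-tabulate (f ∘ suc) h)

Extensional : ((Fin m → Fin n) → ℚ) → Set
Extensional h = h Preserves _≗_ ⟶ _≡_

consF-cong : (k : Fin n) {F F′ : Fin m → Fin n} → F ≗ F′ → consF k F ≗ consF k F′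
consF-cong k F≗F′ zero    = refl
consF-cong k F≗F′ (suc i) = F≗F′ i

consF-∘ : ∀ {M N} (e : Fin M → Fin N) (k : Fin M) (F : Fin m → Fin M) → consF (e k) (e ∘ F) ≗ e ∘ consF k F
consF-∘ e k F zero    = refl
consF-∘ e k F (suc i) = refl

consF-++ : (k : Fin n) (F₁ : Fin a → Fin n) (F₂ : Fin b → Fin n) → consF k (F₁ ++ F₂) ≗ consF k F₁ ++ F₂
consF-++         k F₁ F₂ zero    = refl
consF-++ {a = a} k F₁ F₂ (suc i) = ≡.sym ([,]-map (splitAt a i))

-- Opaque, so that comparing ∑Fun 6 6 h with ∑Fun (3 + 3) (3 + 3) h compares the arguments
-- instead of evaluating a sum over 6⁶ functions.
opaque
  ∑Fun : ∀ m n → ((Fin m → Fin n) → ℚ) → ℚ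
  ∑Fun zero    n h = h (λ ())
  ∑Fun (suc m) n h = sum (λ k → ∑Fun m n (h ∘ consF k))

opaque
  unfolding ∑Fun

  ∑Fun-cong : ∀ m {h h′ : (Fin m → Fin n) → ℚ} → (∀ F → h F ≡ h′ F) → ∑Fun m n h ≡ ∑Fun m n h′
  ∑Fun-cong zero    h≗h′ = h≗h′ _
  ∑Fun-cong (suc m) h≗h′ = sum-cong-≗ (λ k → ∑Fun-cong m (h≗h′ ∘ consF k))

  ∑Fun-zero : ∀ m {h : (Fin m → Fin n) → ℚ} → (∀ F → h F ≡ 0ℚ) → ∑Fun m n h ≡ 0ℚ
  ∑Fun-zero zero    h≗0 = h≗0 _
  ∑Fun-zero (suc m) h≗0 = sum-zero (λ k → ∑Fun-zero m (h≗0 ∘ consF k))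

  ∑Fun-*ˡ : ∀ m c (h : (Fin m → Fin n) → ℚ) → c * ∑Fun m n h ≡ ∑Fun m n (λ F → c * h F)
  ∑Fun-*ˡ         zero    c h = refl
  ∑Fun-*ˡ {n = n} (suc m) c h =
    trans (*-distribˡ-sum c (λ k → ∑Fun m n (h ∘ consF k))) (sum-cong-≗ (λ k → ∑Fun-*ˡ m c (h ∘ consF k)))

  ∑Fun-*ʳ : ∀ m c (h : (Fin m → Fin n) → ℚ) → ∑Fun m n h * c ≡ ∑Fun m n (λ F → h F * c)
  ∑Fun-*ʳ         zero    c h = refl
  ∑Fun-*ʳ {n = n} (suc m) c h =
    trans (*-distribʳ-sum c (λ k → ∑Fun m n (h ∘ consF k))) (sum-cong-≗ (λ k → ∑Fun-*ʳ m c (h ∘ consF k)))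

  listSum-allFuns : ∀ m n {h : (Fin m → Fin n) → ℚ} → Extensional h → listSum (allFuns m n) h ≡ ∑Fun m n h
  listSum-allFuns zero    n h-ext = trans (ℚP.+-identityʳ _) (h-ext (λ ()))
  listSum-allFuns (suc m) n {h} h-ext = begin
    listSum (List.concatMap (λ k → List.map (consF k) (allFuns m n)) (List.allFin n)) h
      ≡⟨ listSum-concatMap _ (List.allFin n) h ⟩
    listSum (List.allFin n) (λ k → listSum (List.map (consF k) (allFuns m n)) h)
      ≡⟨ listSum-tabulate id (λ k → listSum (List.map (consF k) (allFuns m n)) h) ⟩
    sum (λ k → listSum (List.map (consF k) (allFuns m n)) h)
      ≡⟨ sum-cong-≗ (λ k → trans (listSum-map (consF k) (allFuns m n) h)
                                 (listSum-allFuns m n (λ F≗F′ → h-ext (consF-cong k F≗F′)))) ⟩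
    ∑Fun (suc m) n h ∎
    where open ≡-Reasoning

  ∑Fun-restrict : ∀ {M M′ N} {e : Fin M → Fin N} {eᶜ : Fin M′ → Fin N} → Complementary e eᶜ →
                  ∀ m {h : (Fin m → Fin N) → ℚ} → Extensional h →
                  (∀ F i j → F i ≡ eᶜ j → h F ≡ 0ℚ) →
                  ∑Fun m N h ≡ ∑Fun m M (λ F → h (e ∘ F))
  ∑Fun-restrict e∣eᶜ zero    h-ext h-vanish = h-ext (λ ())
  ∑Fun-restrict {M} {N = N} {e} {eᶜ} e∣eᶜ (suc m) {h} h-ext h-vanish = begin
    sum (λ k → ∑Fun m N (h ∘ consF k))
      ≡⟨ Complementary.sum-split e∣eᶜ _ ⟩
    sum (λ k → ∑Fun m N (h ∘ consF (e k))) + sum (λ j → ∑Fun m N (h ∘ consF (eᶜ j)))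
      ≡⟨ cong (_+_ (sum (λ k → ∑Fun m N (h ∘ consF (e k)))))
              (sum-zero (λ j → ∑Fun-zero m (λ F → h-vanish (consF (eᶜ j) F) zero j refl))) ⟩
    sum (λ k → ∑Fun m N (h ∘ consF (e k))) + 0ℚ
      ≡⟨ ℚP.+-identityʳ _ ⟩
    sum (λ k → ∑Fun m N (h ∘ consF (e k)))
      ≡⟨ sum-cong-≗ restricted ⟩
    sum (λ k → ∑Fun m M (λ F → h (e ∘ consF k F))) ∎
    where
    open ≡-Reasoning
    restricted : ∀ k → ∑Fun m N (h ∘ consF (e k)) ≡ ∑Fun m M (λ F → h (e ∘ consF k F))
    restricted k = trans (∑Fun-restrict e∣eᶜ m (λ F≗F′ → h-ext (consF-cong (e k) F≗F′))
                                         (λ F i → h-vanish (consF (e k) F) (suc i)))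
                         (∑Fun-cong m (λ F → h-ext (consF-∘ e k F)))

  ∑Fun-++ : ∀ a {b n} {h : (Fin (a ℕ.+ b) → Fin n) → ℚ} → Extensional h →
            ∑Fun (a ℕ.+ b) n h ≡ ∑Fun a n (λ F₁ → ∑Fun b n (λ F₂ → h (F₁ ++ F₂)))
  ∑Fun-++ zero    h-ext = refl
  ∑Fun-++ (suc a) {b} {n} {h} h-ext = sum-cong-≗ λ k →
    trans (∑Fun-++ a (λ F≗F′ → h-ext (consF-cong k F≗F′)))
          (∑Fun-cong a (λ F₁ → ∑Fun-cong b (λ F₂ → h-ext (consF-++ k F₁ F₂))))

∑Fun-product : ∀ a b {n₁ n₂} (f : (Fin a → Fin n₁) → ℚ) (g : (Fin b → Fin n₂) → ℚ) →
               ∑Fun a n₁ (λ F₁ → ∑Fun b n₂ (λ F₂ → f F₁ * g F₂)) ≡ ∑Fun a n₁ f * ∑Fun b n₂ g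
∑Fun-product a b f g =
  trans (∑Fun-cong a (λ F₁ → ≡.sym (∑Fun-*ˡ b (f F₁) g))) (≡.sym (∑Fun-*ʳ a _ f))

∑Fun-blocks : ∀ a {b N M₁ M₁′ M₂ M₂′}
              {e₁ : Fin M₁ → Fin N} {e₁ᶜ : Fin M₁′ → Fin N} {e₂ : Fin M₂ → Fin N} {e₂ᶜ : Fin M₂′ → Fin N} →
              Complementary e₁ e₁ᶜ → Complementary e₂ e₂ᶜ →
              {h : (Fin (a ℕ.+ b) → Fin N) → ℚ} → Extensional h →
              (∀ F i j → F (i ↑ˡ b) ≡ e₁ᶜ j → h F ≡ 0ℚ) → (∀ F i j → F (a ↑ʳ i) ≡ e₂ᶜ j → h F ≡ 0ℚ) →
              ∑Fun (a ℕ.+ b) N h ≡ ∑Fun a M₁ (λ F₁ → ∑Fun b M₂ (λ F₂ → h ((e₁ ∘ F₁) ++ (e₂ ∘ F₂))))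
∑Fun-blocks a {b} {N} {M₂ = M₂} {e₁ᶜ = e₁ᶜ} {e₂ = e₂} e₁∣e₁ᶜ e₂∣e₂ᶜ {h} h-ext vanishˡ vanishʳ =
  trans (∑Fun-++ a h-ext) (trans (∑Fun-cong a inner) (∑Fun-restrict e₁∣e₁ᶜ a outer-ext outer-vanish))
  where
  inner : ∀ F₁ → ∑Fun b N (λ F₂ → h (F₁ ++ F₂)) ≡ ∑Fun b M₂ (λ F₂ → h (F₁ ++ (e₂ ∘ F₂)))
  inner F₁ = ∑Fun-restrict e₂∣e₂ᶜ b (λ F₂≗F₂′ → h-ext (++-cong F₁ F₁ (λ _ → refl) F₂≗F₂′))
               (λ F₂ i j F₂i≡ → vanishʳ (F₁ ++ F₂) i j (trans (lookup-++ʳ F₁ F₂ i) F₂i≡))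
  outer-ext : Extensional (λ F₁ → ∑Fun b M₂ (λ F₂ → h (F₁ ++ (e₂ ∘ F₂))))
  outer-ext F₁≗F₁′ = ∑Fun-cong b (λ F₂ → h-ext (++-cong _ _ F₁≗F₁′ (λ _ → refl)))
  outer-vanish : ∀ F₁ i j → F₁ i ≡ e₁ᶜ j → ∑Fun b M₂ (λ F₂ → h (F₁ ++ (e₂ ∘ F₂))) ≡ 0ℚ
  outer-vanish F₁ i j F₁i≡ = ∑Fun-zero b (λ F₂ → vanishˡ (F₁ ++ (e₂ ∘ F₂)) i j (trans (lookup-++ˡ F₁ _ i) F₁i≡))

allB-cong : {f g : Fin n → Bool} → f ≗ g → allB f ≡ allB g
allB-cong {zero}  _   = refl
allB-cong {suc n} f≗g = cong₂ _∧_ (f≗g zero) (allB-cong (f≗g ∘ suc))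

allB-++ : ∀ a {b} (f : Fin (a ℕ.+ b) → Bool) → allB f ≡ allB (f ∘ (_↑ˡ b)) ∧ allB (f ∘ (a ↑ʳ_))
allB-++ zero    f = refl
allB-++ (suc a) f = trans (cong (f zero ∧_) (allB-++ a (f ∘ suc))) (≡.sym (∧-assoc (f zero) _ _))

allB-false : (f : Fin n → Bool) (i : Fin n) → f i ≡ false → allB f ≡ false
allB-false f zero    fi≡false = cong (_∧ allB (f ∘ suc)) fi≡false
allB-false f (suc i) fi≡false = trans (cong (f zero ∧_) (allB-false (f ∘ suc) i fi≡false)) (∧-zeroʳ (f zero))

prodFin-cong : {f g : Fin n → ℚ} → f ≗ g → prodFin f ≡ prodFin g
prodFin-cong {zero}  _   = refl
prodFin-cong {suc n} f≗g = cong₂ _*_ (f≗g zero) (prodFin-cong (f≗g ∘ suc))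

prodFin-++ : ∀ a {b} (f : Fin (a ℕ.+ b) → ℚ) → prodFin f ≡ prodFin (f ∘ (_↑ˡ b)) * prodFin (f ∘ (a ↑ʳ_))
prodFin-++ zero    f = ≡.sym (ℚP.*-identityˡ _)
prodFin-++ (suc a) f = trans (cong (_*_ (f zero)) (prodFin-++ a (f ∘ suc))) (≡.sym (ℚP.*-assoc (f zero) _ _))

matchedAt : Graph n → (Fin n → Fin n) → Fin n → Bool
matchedAt G M i = eqF (M (M i)) i ∧ (not (eqF (M i) i) ∧ adj G i (M i))

weightAt : Assignment n → (Fin n → Fin n) → Fin n → ℚ
weightAt x M i = if ltF i (M i) then edgeVar x i (M i) else 1ℚ

matchingTerm : Graph n → Assignment n → (Fin n → Fin n) → ℚ
matchingTerm G x M = if isPerfectMatching G M then matchingWeight x M else 0ℚ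

matchingTerm-ext : (G : Graph n) (x : Assignment n) → Extensional (matchingTerm G x)
matchingTerm-ext G x {M} {M′} M≗M′ =
  cong₂ (λ p w → if p then w else 0ℚ) (allB-cong matched) (prodFin-cong weighted)
  where
  matched : matchedAt G M ≗ matchedAt G M′
  matched i rewrite M≗M′ i | M≗M′ (M′ i) = refl
  weighted : weightAt x M ≗ weightAt x M′
  weighted i rewrite M≗M′ i = refl

matchingTerm-nonedge : (G : Graph n) (x : Assignment n) (M : Fin n → Fin n) (i : Fin n) →
                       adj G i (M i) ≡ false → matchingTerm G x M ≡ 0ℚ
matchingTerm-nonedge G x M i nonedge =
  cong (λ p → if p then matchingWeight x M else 0ℚ) (allB-false (matchedAt G M) i unmatched)
  where
  unmatched : matchedAt G M i ≡ false
  unmatched rewrite nonedge =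
    trans (cong (eqF (M (M i)) i ∧_) (∧-zeroʳ (not (eqF (M i) i)))) (∧-zeroʳ (eqF (M (M i)) i))

PM-∑Fun : (G : Graph n) (x : Assignment n) → PM G x ≡ ∑Fun n n (matchingTerm G x)
PM-∑Fun {n} G x = listSum-allFuns n n (matchingTerm-ext G x)

matchingSum-blocks : ∀ a b {M₁ M₁′ M₂ M₂′} (G : Graph (a ℕ.+ b)) (x : Assignment (a ℕ.+ b))
                     {e₁ : Fin M₁ → Fin (a ℕ.+ b)} {e₁ᶜ : Fin M₁′ → Fin (a ℕ.+ b)}
                     {e₂ : Fin M₂ → Fin (a ℕ.+ b)} {e₂ᶜ : Fin M₂′ → Fin (a ℕ.+ b)} →
                     Complementary e₁ e₁ᶜ → Complementary e₂ e₂ᶜ →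
                     (∀ i j → adj G (i ↑ˡ b) (e₁ᶜ j) ≡ false) → (∀ i j → adj G (a ↑ʳ i) (e₂ᶜ j) ≡ false) →
                     ∑Fun (a ℕ.+ b) (a ℕ.+ b) (matchingTerm G x) ≡
                     ∑Fun a M₁ (λ F₁ → ∑Fun b M₂ (λ F₂ → matchingTerm G x ((e₁ ∘ F₁) ++ (e₂ ∘ F₂))))
matchingSum-blocks a b G x e₁∣e₁ᶜ e₂∣e₂ᶜ nonedgeˡ nonedgeʳ =
  ∑Fun-blocks a e₁∣e₁ᶜ e₂∣e₂ᶜ (matchingTerm-ext G x)
    (λ M i j Mi≡ → matchingTerm-nonedge G x M (i ↑ˡ b) (trans (cong (adj G (i ↑ˡ b)) Mi≡) (nonedgeˡ i j)))
    (λ M i j Mi≡ → matchingTerm-nonedge G x M (a ↑ʳ i) (trans (cong (adj G (a ↑ʳ i)) Mi≡) (nonedgeʳ i j)))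

+-<ᵇ : ∀ c m n → ((c ℕ.+ m) <ᵇ (c ℕ.+ n)) ≡ (m <ᵇ n)
+-<ᵇ zero    m n = refl
+-<ᵇ (suc c) m n = +-<ᵇ c m n

+-≡ᵇ : ∀ c m n → ((c ℕ.+ m) ≡ᵇ (c ℕ.+ n)) ≡ (m ≡ᵇ n)
+-≡ᵇ zero    m n = refl
+-≡ᵇ (suc c) m n = +-≡ᵇ c m n

-- The embeddings _↑ˡ b and a ↑ʳ_ of the two parts shift vertex indices by a constant, so they
-- commute with the comparisons ltF and eqF on which the definitions depend.
module Shift {a n : ℕ} (c : ℕ) (ι : Fin a → Fin n) (toℕ-ι : ∀ u → toℕ (ι u) ≡ c ℕ.+ toℕ u) where

  ltF-ι : ∀ u v → ltF (ι u) (ι v) ≡ ltF u v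
  ltF-ι u v = trans (cong₂ _<ᵇ_ (toℕ-ι u) (toℕ-ι v)) (+-<ᵇ c (toℕ u) (toℕ v))

  eqF-ι : ∀ u v → eqF (ι u) (ι v) ≡ eqF u v
  eqF-ι u v = trans (cong₂ _≡ᵇ_ (toℕ-ι u) (toℕ-ι v)) (+-≡ᵇ c (toℕ u) (toℕ v))

  edgeVar-ι : (x : Assignment n) (x′ : Assignment a) → (∀ u v → x (ι u) (ι v) ≡ x′ u v) →
              ∀ u v → edgeVar x (ι u) (ι v) ≡ edgeVar x′ u v
  edgeVar-ι x x′ x-ι u v rewrite ltF-ι u v | x-ι u v | x-ι v u = refl

  matchedAt-ι : (G : Graph n) (G′ : Graph a) (M : Fin n → Fin n) (F : Fin a → Fin a) →
                (∀ u v → adj G (ι u) (ι v) ≡ adj G′ u v) → (∀ u → M (ι u) ≡ ι (F u)) →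
                ∀ u → matchedAt G M (ι u) ≡ matchedAt G′ F u
  matchedAt-ι G G′ M F adj-ι M-ι u
    rewrite M-ι u | M-ι (F u) | eqF-ι (F (F u)) u | eqF-ι (F u) u | adj-ι u (F u) = refl

  weightAt-ι : (x : Assignment n) (x′ : Assignment a) (M : Fin n → Fin n) (F : Fin a → Fin a) →
               (∀ u v → x (ι u) (ι v) ≡ x′ u v) → (∀ u → M (ι u) ≡ ι (F u)) →
               ∀ u → weightAt x M (ι u) ≡ weightAt x′ F u
  weightAt-ι x x′ M F x-ι M-ι u rewrite M-ι u | edgeVar-ι x x′ x-ι u (F u) | ltF-ι u (F u) = refl

  skewMatrix-ι : (G : Graph n) (G′ : Graph a) (x : Assignment n) (x′ : Assignment a) →
                 (∀ u v → adj G (ι u) (ι v) ≡ adj G′ u v) → (∀ u v → x (ι u) (ι v) ≡ x′ u v) →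
                 ∀ (D : Orientation n) u v →
                 skewMatrix G D x (ι u) (ι v) ≡ skewMatrix G′ (λ u v → D (ι u) (ι v)) x′ u v
  skewMatrix-ι G G′ x x′ adj-ι x-ι D u v rewrite adj-ι u v | edgeVar-ι x x′ x-ι u v | ltF-ι u v = refl

module Left  (a b : ℕ) = Shift {a} {a ℕ.+ b} 0 (_↑ˡ b) (λ u → toℕ-↑ˡ u b)
module Right (a b : ℕ) = Shift {b} {a ℕ.+ b} a (a ↑ʳ_) (toℕ-↑ʳ a)

↑-elim : ∀ a {b} {P : Fin (a ℕ.+ b) → Set} → (∀ u → P (u ↑ˡ b)) → (∀ v → P (a ↑ʳ v)) → ∀ i → P i
↑-elim a {b} {P} left right i = subst P (join-splitAt a b i) (by-side (splitAt a i))
  where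
  by-side : ∀ s → P (join a b s)
  by-side (inj₁ u) = left u
  by-side (inj₂ v) = right v

Matrix : ℕ → Set
Matrix n = Fin n → Fin n → ℚ

_⊕_ : Matrix a → Matrix b → Matrix (a ℕ.+ b)
_⊕_ {a} B C i j with splitAt a i | splitAt a j
... | inj₁ u | inj₁ v = B u v
... | inj₂ u | inj₂ v = C u v
... | inj₁ _ | inj₂ _ = 0ℚ
... | inj₂ _ | inj₁ _ = 0ℚ

module _ (B : Matrix a) (C : Matrix b) where

  ⊕-↑ˡ : ∀ u v → (B ⊕ C) (u ↑ˡ b) (v ↑ˡ b) ≡ B u v
  ⊕-↑ˡ u v rewrite splitAt-↑ˡ a u b | splitAt-↑ˡ a v b = refl

  ⊕-↑ʳ : ∀ u v → (B ⊕ C) (a ↑ʳ u) (a ↑ʳ v) ≡ C u v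
  ⊕-↑ʳ u v rewrite splitAt-↑ʳ a b u | splitAt-↑ʳ a b v = refl

  ⊕-↑ˡ↑ʳ : ∀ u v → (B ⊕ C) (u ↑ˡ b) (a ↑ʳ v) ≡ 0ℚ
  ⊕-↑ˡ↑ʳ u v rewrite splitAt-↑ˡ a u b | splitAt-↑ʳ a b v = refl

  ⊕-↑ʳ↑ˡ : ∀ u v → (B ⊕ C) (a ↑ʳ u) (v ↑ˡ b) ≡ 0ℚ
  ⊕-↑ʳ↑ˡ u v rewrite splitAt-↑ʳ a b u | splitAt-↑ˡ a v b = refl

  ≡-⊕ : {A : Matrix (a ℕ.+ b)} →
        (∀ u v → A (u ↑ˡ b) (v ↑ˡ b) ≡ B u v) → (∀ u v → A (a ↑ʳ u) (a ↑ʳ v) ≡ C u v) →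
        (∀ u v → A (u ↑ˡ b) (a ↑ʳ v) ≡ 0ℚ) → (∀ u v → A (a ↑ʳ u) (v ↑ˡ b) ≡ 0ℚ) →
        ∀ i j → A i j ≡ (B ⊕ C) i j
  ≡-⊕ {A} ll rr lr rl = ↑-elim a (λ u → ↑-elim a (λ v → trans (ll u v) (≡.sym (⊕-↑ˡ u v)))
                                                  (λ v → trans (lr u v) (≡.sym (⊕-↑ˡ↑ʳ u v))))
                                 (λ u → ↑-elim a (λ v → trans (rl u v) (≡.sym (⊕-↑ʳ↑ˡ u v)))
                                                  (λ v → trans (rr u v) (≡.sym (⊕-↑ʳ u v))))

module _ (G : Graph a) (H : Graph b) where

  adj-⊔ᴳ-↑ˡ : ∀ u v → adj (G ⊔ᴳ H) (u ↑ˡ b) (v ↑ˡ b) ≡ adj G u v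
  adj-⊔ᴳ-↑ˡ u v rewrite splitAt-↑ˡ a u b | splitAt-↑ˡ a v b = refl

  adj-⊔ᴳ-↑ʳ : ∀ u v → adj (G ⊔ᴳ H) (a ↑ʳ u) (a ↑ʳ v) ≡ adj H u v
  adj-⊔ᴳ-↑ʳ u v rewrite splitAt-↑ʳ a b u | splitAt-↑ʳ a b v = refl

  adj-⊔ᴳ-↑ˡ↑ʳ : ∀ u v → adj (G ⊔ᴳ H) (u ↑ˡ b) (a ↑ʳ v) ≡ false
  adj-⊔ᴳ-↑ˡ↑ʳ u v rewrite splitAt-↑ˡ a u b | splitAt-↑ʳ a b v = refl

  adj-⊔ᴳ-↑ʳ↑ˡ : ∀ u v → adj (G ⊔ᴳ H) (a ↑ʳ u) (v ↑ˡ b) ≡ false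
  adj-⊔ᴳ-↑ʳ↑ˡ u v rewrite splitAt-↑ʳ a b u | splitAt-↑ˡ a v b = refl

Pf-cong : ∀ m {A B : Matrix m} → (∀ i j → A i j ≡ B i j) → Pf m A ≡ Pf m B
Pf-cong zero          _   = refl
Pf-cong (suc zero)    _   = refl
Pf-cong (suc (suc m)) A≡B = sumFin-cong λ j →
  cong₂ (λ e p → sign (toℕ j) * e * p) (A≡B zero (suc j))
        (Pf-cong m (λ u v → A≡B (suc (punchIn j u)) (suc (punchIn j v))))

minor : Matrix (suc (suc m)) → Fin (suc m) → Matrix m
minor A j u v = A (suc (punchIn j u)) (suc (punchIn j v))

punchIn-↑ˡ : (i : Fin (suc a)) (u : Fin a) (b : ℕ) → punchIn (i ↑ˡ b) (u ↑ˡ b) ≡ punchIn i u ↑ˡ b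
punchIn-↑ˡ zero    u       b = refl
punchIn-↑ˡ (suc i) zero    b = refl
punchIn-↑ˡ (suc i) (suc u) b = cong suc (punchIn-↑ˡ i u b)

punchIn-↑ʳ : (i : Fin (suc a)) (b : ℕ) (v : Fin b) → punchIn (i ↑ˡ b) (a ↑ʳ v) ≡ suc a ↑ʳ v
punchIn-↑ʳ             zero    b v = refl
punchIn-↑ʳ {a = suc a} (suc i) b v = cong suc (punchIn-↑ʳ i b v)

minor-⊕ : (B : Matrix (suc (suc a))) (C : Matrix b) (i : Fin (suc a)) →
          ∀ u v → minor (B ⊕ C) (i ↑ˡ b) u v ≡ (minor B i ⊕ C) u v
minor-⊕ {a} {b} B C i = ≡-⊕ (minor B i) C
  (λ u v → trans (cong₂ entry (punchIn-↑ˡ i u b) (punchIn-↑ˡ i v b)) (⊕-↑ˡ B C (suc′ u) (suc′ v)))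
  (λ u v → trans (cong₂ entry (punchIn-↑ʳ i b u) (punchIn-↑ʳ i b v)) (⊕-↑ʳ B C u v))
  (λ u v → trans (cong₂ entry (punchIn-↑ˡ i u b) (punchIn-↑ʳ i b v)) (⊕-↑ˡ↑ʳ B C (suc′ u) v))
  (λ u v → trans (cong₂ entry (punchIn-↑ʳ i b u) (punchIn-↑ˡ i v b)) (⊕-↑ʳ↑ˡ B C u (suc′ v)))
  where
  entry : Fin (suc a ℕ.+ b) → Fin (suc a ℕ.+ b) → ℚ
  entry p q = (B ⊕ C) (suc p) (suc q)
  suc′ : Fin a → Fin (suc (suc a))
  suc′ u = suc (punchIn i u)

zero-term : ∀ s p → s * 0ℚ * p ≡ 0ℚ
zero-term s p = trans (cong (_* p) (ℚP.*-zeroʳ s)) (ℚP.*-zeroˡ p)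

-- Expanding along the first row, only the columns inside the first block contribute, and each
-- of their minors is again block diagonal.
Pf-⊕ : ∀ a {b} (B : Matrix a) (C : Matrix b) → Pf (a ℕ.+ b) (B ⊕ C) ≡ Pf a B * Pf b C
Pf-⊕ zero          B C = ≡.sym (ℚP.*-identityˡ _)
Pf-⊕ (suc zero) {zero}  B C = refl
Pf-⊕ (suc zero) {suc b} B C =
  trans (sumFin≡sum term) (trans (sum-zero term≡0) (≡.sym (ℚP.*-zeroˡ (Pf (suc b) C))))
  where
  term : Fin (suc b) → ℚ
  term j = sign (toℕ j) * (B ⊕ C) zero (suc j) * Pf b (minor (B ⊕ C) j)
  term≡0 : ∀ j → term j ≡ 0ℚ
  term≡0 j = trans (cong (λ e → sign (toℕ j) * e * Pf b (minor (B ⊕ C) j)) (⊕-↑ˡ↑ʳ B C zero j))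
                   (zero-term (sign (toℕ j)) (Pf b (minor (B ⊕ C) j)))
Pf-⊕ (suc (suc a)) {b} B C = begin
  Pf (suc (suc a) ℕ.+ b) (B ⊕ C)                  ≡⟨ sumFin≡sum term ⟩
  sum term                                         ≡⟨ sum-↑ˡ-↑ʳ (suc a) term ⟩
  sum (term ∘ (_↑ˡ b)) + sum (term ∘ (suc a ↑ʳ_)) ≡⟨ cong₂ _+_ (sum-cong-≗ left-term) (sum-zero right-term) ⟩
  sum (λ i → termB i * Pf b C) + 0ℚ               ≡⟨ ℚP.+-identityʳ _ ⟩
  sum (λ i → termB i * Pf b C)                     ≡⟨ ≡.sym (*-distribʳ-sum (Pf b C) termB) ⟩
  sum termB * Pf b C                               ≡⟨ cong (_* Pf b C) (≡.sym (sumFin≡sum termB)) ⟩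
  Pf (suc (suc a)) B * Pf b C ∎
  where
  open ≡-Reasoning
  term : Fin (suc a ℕ.+ b) → ℚ
  term j = sign (toℕ j) * (B ⊕ C) zero (suc j) * Pf (a ℕ.+ b) (minor (B ⊕ C) j)
  termB : Fin (suc a) → ℚ
  termB i = sign (toℕ i) * B zero (suc i) * Pf a (minor B i)
  left-term : ∀ i → term (i ↑ˡ b) ≡ termB i * Pf b C
  left-term i = trans
    (cong₂ _*_ (cong₂ _*_ (cong sign (toℕ-↑ˡ i b)) (⊕-↑ˡ B C zero (suc i)))
               (trans (Pf-cong (a ℕ.+ b) (minor-⊕ B C i)) (Pf-⊕ a (minor B i) C)))
    (≡.sym (ℚP.*-assoc (sign (toℕ i) * B zero (suc i)) _ _))
  right-term : ∀ v → term (suc a ↑ʳ v) ≡ 0ℚ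
  right-term v = trans (cong (λ e → sign (toℕ j) * e * Pf (a ℕ.+ b) (minor (B ⊕ C) j)) (⊕-↑ˡ↑ʳ B C zero v))
                       (zero-term (sign (toℕ j)) (Pf (a ℕ.+ b) (minor (B ⊕ C) j)))
    where j = suc a ↑ʳ v

topLeft : ∀ b → (Fin (a ℕ.+ b) → Fin (a ℕ.+ b) → A) → Fin a → Fin a → A
topLeft b D u v = D (u ↑ˡ b) (v ↑ˡ b)

bottomRight : ∀ a → (Fin (a ℕ.+ b) → Fin (a ℕ.+ b) → A) → Fin b → Fin b → A
bottomRight a D u v = D (a ↑ʳ u) (a ↑ʳ v)

skewMatrix-nonedge : (G : Graph n) (D : Orientation n) (x : Assignment n) {i j : Fin n} →
                     adj G i j ≡ false → skewMatrix G D x i j ≡ 0ℚ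
skewMatrix-nonedge G D x nonedge rewrite nonedge = refl

module _ (G : Graph a) (H : Graph b) (X : Assignment a) (Y : Assignment b) where

  skewMatrix-⊔ : (D : Orientation (a ℕ.+ b)) → ∀ i j →
                 skewMatrix (G ⊔ᴳ H) D (X ⊕ Y) i j ≡
                 (skewMatrix G (topLeft b D) X ⊕ skewMatrix H (bottomRight a D) Y) i j
  skewMatrix-⊔ D = ≡-⊕ _ _
    (Left.skewMatrix-ι a b (G ⊔ᴳ H) G (X ⊕ Y) X (adj-⊔ᴳ-↑ˡ G H) (⊕-↑ˡ X Y) D)
    (Right.skewMatrix-ι a b (G ⊔ᴳ H) H (X ⊕ Y) Y (adj-⊔ᴳ-↑ʳ G H) (⊕-↑ʳ X Y) D)
    (λ u v → skewMatrix-nonedge (G ⊔ᴳ H) D (X ⊕ Y) (adj-⊔ᴳ-↑ˡ↑ʳ G H u v))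
    (λ u v → skewMatrix-nonedge (G ⊔ᴳ H) D (X ⊕ Y) (adj-⊔ᴳ-↑ʳ↑ˡ G H u v))

  Pf-⊔ : (D : Orientation (a ℕ.+ b)) →
         Pf (a ℕ.+ b) (skewMatrix (G ⊔ᴳ H) D (X ⊕ Y)) ≡
         Pf a (skewMatrix G (topLeft b D) X) * Pf b (skewMatrix H (bottomRight a D) Y)
  Pf-⊔ D = trans (Pf-cong (a ℕ.+ b) (skewMatrix-⊔ D)) (Pf-⊕ a _ _)

  matchingTerm-⊔ : (F₁ : Fin a → Fin a) (F₂ : Fin b → Fin b) →
                   matchingTerm (G ⊔ᴳ H) (X ⊕ Y) (((_↑ˡ b) ∘ F₁) ++ ((a ↑ʳ_) ∘ F₂)) ≡
                   matchingTerm G X F₁ * matchingTerm H Y F₂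
  matchingTerm-⊔ F₁ F₂ =
    trans (cong₂ (λ p w → if p then w else 0ℚ) perfect weight)
          (if-∧-* (isPerfectMatching G F₁) (isPerfectMatching H F₂) (matchingWeight X F₁) (matchingWeight Y F₂))
    where
    M : Fin (a ℕ.+ b) → Fin (a ℕ.+ b)
    M = ((_↑ˡ b) ∘ F₁) ++ ((a ↑ʳ_) ∘ F₂)
    M-↑ˡ : ∀ u → M (u ↑ˡ b) ≡ F₁ u ↑ˡ b
    M-↑ˡ = lookup-++ˡ ((_↑ˡ b) ∘ F₁) ((a ↑ʳ_) ∘ F₂)
    M-↑ʳ : ∀ v → M (a ↑ʳ v) ≡ a ↑ʳ F₂ v
    M-↑ʳ = lookup-++ʳ ((_↑ˡ b) ∘ F₁) ((a ↑ʳ_) ∘ F₂)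
    perfect : isPerfectMatching (G ⊔ᴳ H) M ≡ isPerfectMatching G F₁ ∧ isPerfectMatching H F₂
    perfect = trans (allB-++ a (matchedAt (G ⊔ᴳ H) M))
      (cong₂ _∧_ (allB-cong (Left.matchedAt-ι a b (G ⊔ᴳ H) G M F₁ (adj-⊔ᴳ-↑ˡ G H) M-↑ˡ))
                 (allB-cong (Right.matchedAt-ι a b (G ⊔ᴳ H) H M F₂ (adj-⊔ᴳ-↑ʳ G H) M-↑ʳ)))
    weight : matchingWeight (X ⊕ Y) M ≡ matchingWeight X F₁ * matchingWeight Y F₂
    weight = trans (prodFin-++ a (weightAt (X ⊕ Y) M))
      (cong₂ _*_ (prodFin-cong (Left.weightAt-ι a b (X ⊕ Y) X M F₁ (⊕-↑ˡ X Y) M-↑ˡ))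
                 (prodFin-cong (Right.weightAt-ι a b (X ⊕ Y) Y M F₂ (⊕-↑ʳ X Y) M-↑ʳ)))
    if-∧-* : ∀ p q s t → (if p ∧ q then s * t else 0ℚ) ≡ (if p then s else 0ℚ) * (if q then t else 0ℚ)
    if-∧-* true  true  s t = refl
    if-∧-* true  false s t = ≡.sym (ℚP.*-zeroʳ s)
    if-∧-* false q     s t = ≡.sym (ℚP.*-zeroˡ (if q then t else 0ℚ))

  PM-⊔ : PM (G ⊔ᴳ H) (X ⊕ Y) ≡ PM G X * PM H Y
  PM-⊔ = begin
    PM (G ⊔ᴳ H) (X ⊕ Y)
      ≡⟨ PM-∑Fun (G ⊔ᴳ H) (X ⊕ Y) ⟩
    ∑Fun (a ℕ.+ b) (a ℕ.+ b) (matchingTerm (G ⊔ᴳ H) (X ⊕ Y))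
      ≡⟨ matchingSum-blocks a b (G ⊔ᴳ H) (X ⊕ Y) (↑ˡ-↑ʳ-complementary a b) (↑ʳ-↑ˡ-complementary a b)
                            (adj-⊔ᴳ-↑ˡ↑ʳ G H) (adj-⊔ᴳ-↑ʳ↑ˡ G H) ⟩
    ∑Fun a a (λ F₁ → ∑Fun b b (λ F₂ → matchingTerm (G ⊔ᴳ H) (X ⊕ Y) (((_↑ˡ b) ∘ F₁) ++ ((a ↑ʳ_) ∘ F₂))))
      ≡⟨ ∑Fun-cong a (λ F₁ → ∑Fun-cong b (matchingTerm-⊔ F₁)) ⟩
    ∑Fun a a (λ F₁ → ∑Fun b b (λ F₂ → matchingTerm G X F₁ * matchingTerm H Y F₂))
      ≡⟨ ∑Fun-product a b (matchingTerm G X) (matchingTerm H Y) ⟩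
    ∑Fun a a (matchingTerm G X) * ∑Fun b b (matchingTerm H Y)
      ≡⟨ ≡.sym (cong₂ _*_ (PM-∑Fun G X) (PM-∑Fun H Y)) ⟩
    PM G X * PM H Y ∎
    where open ≡-Reasoning

Represents : Graph n → (Fin k → Orientation n) → (Fin k → ℚ) → ℚ → Set
Represents {n} G D c α = ∀ x → α * PM G x ≡ sumFin (λ i → c i * Pf n (skewMatrix G (D i) x))

represents-⊔ : (G : Graph a) (H : Graph b) {D : Fin k → Orientation (a ℕ.+ b)} {c : Fin k → ℚ} {α : ℚ} →
               Represents (G ⊔ᴳ H) D c α → ∀ X →
               Represents H (λ i → bottomRight a (D i)) (λ i → c i * Pf a (skewMatrix G (topLeft b (D i)) X))
                          (α * PM G X)
represents-⊔ {a} {b} G H {D} {c} {α} rep X Y = begin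
  α * PM G X * PM H Y
    ≡⟨ ℚP.*-assoc α (PM G X) (PM H Y) ⟩
  α * (PM G X * PM H Y)
    ≡⟨ cong (α *_) (≡.sym (PM-⊔ G H X Y)) ⟩
  α * PM (G ⊔ᴳ H) (X ⊕ Y)
    ≡⟨ rep (X ⊕ Y) ⟩
  sumFin (λ i → c i * Pf (a ℕ.+ b) (skewMatrix (G ⊔ᴳ H) (D i) (X ⊕ Y)))
    ≡⟨ sumFin-cong (λ i → trans (cong (c i *_) (Pf-⊔ G H X Y (D i))) (≡.sym (ℚP.*-assoc (c i) _ _))) ⟩
  sumFin (λ i → c i * Pf a (skewMatrix G (topLeft b (D i)) X) * Pf b (skewMatrix H (bottomRight a (D i)) Y)) ∎
  where open ≡-Reasoning

χ≢0 : ℚ → ℕ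
χ≢0 q = if does (q ≟ 0ℚ) then 0 else 1

χ≢0≤1 : ∀ q → χ≢0 q ≤ 1
χ≢0≤1 q with q ≟ 0ℚ
... | yes _ = z≤n
... | no  _ = ℕP.≤-refl

χ≢0≡0 : ∀ q → χ≢0 q ≡ 0 → q ≡ 0ℚ
χ≢0≡0 q χ≡0 with q ≟ 0ℚ | χ≡0
... | yes q≡0 | _ = q≡0
... | no  _   | ()

χ≢0-* : ∀ p q → χ≢0 (p * q) ≤ χ≢0 p ℕ.* χ≢0 q
χ≢0-* p q with p ≟ 0ℚ | q ≟ 0ℚ
... | yes refl | _        = ℕP.≤-reflexive (cong χ≢0 (ℚP.*-zeroˡ q))
... | no  _    | yes refl = ℕP.≤-reflexive (cong χ≢0 (ℚP.*-zeroʳ p))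
... | no  _    | no  _    = χ≢0≤1 (p * q)

nonzeros : (Fin k → ℚ) → ℕ
nonzeros c = ℕΣ.sum (χ≢0 ∘ c)

sum-const : ∀ n x → ℕΣ.sum {n} (λ _ → x) ≡ n ℕ.* x
sum-const zero    x = refl
sum-const (suc n) x = cong (x ℕ.+_) (sum-const n x)

sum-mono-≤ : {f g : Fin n → ℕ} → (∀ i → f i ≤ g i) → ℕΣ.sum f ≤ ℕΣ.sum g
sum-mono-≤ {zero}  _   = z≤n
sum-mono-≤ {suc n} f≤g = ℕP.+-mono-≤ (f≤g zero) (sum-mono-≤ (f≤g ∘ suc))

nonzeros≤ : (c : Fin k → ℚ) → nonzeros c ≤ k
nonzeros≤ {k} c =
  ℕP.≤-trans (sum-mono-≤ (χ≢0≤1 ∘ c)) (ℕP.≤-reflexive (trans (sum-const k 1) (ℕP.*-identityʳ k)))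

nonzeros≡0 : (c : Fin k → ℚ) → nonzeros c ≡ 0 → ∀ i → c i ≡ 0ℚ
nonzeros≡0 c none zero    = χ≢0≡0 (c zero) (ℕP.m+n≡0⇒m≡0 (χ≢0 (c zero)) none)
nonzeros≡0 c none (suc i) = nonzeros≡0 (c ∘ suc) (ℕP.m+n≡0⇒n≡0 (χ≢0 (c zero)) none) i

nonzeros-weighted : ∀ {s t} (c : Fin k → ℚ) (P : Fin k → Fin s → ℚ) → (∀ i → ℕΣ.sum (χ≢0 ∘ P i) ≤ t) →
                    ℕΣ.sum (λ f → nonzeros (λ i → c i * P i f)) ≤ t ℕ.* nonzeros c
nonzeros-weighted {t = t} c P sparse = begin
  ℕΣ.sum (λ f → ℕΣ.sum (λ i → χ≢0 (c i * P i f)))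
    ≡⟨ ℕΣ.∑-comm (λ f i → χ≢0 (c i * P i f)) ⟩
  ℕΣ.sum (λ i → ℕΣ.sum (λ f → χ≢0 (c i * P i f)))
    ≤⟨ sum-mono-≤ (λ i → sum-mono-≤ (λ f → χ≢0-* (c i) (P i f))) ⟩
  ℕΣ.sum (λ i → ℕΣ.sum (λ f → χ≢0 (c i) ℕ.* χ≢0 (P i f)))
    ≡⟨ ℕΣ.sum-cong-≗ (λ i → ≡.sym (ℕΣ.*-distribˡ-sum (χ≢0 (c i)) (χ≢0 ∘ P i))) ⟩
  ℕΣ.sum (λ i → χ≢0 (c i) ℕ.* ℕΣ.sum (χ≢0 ∘ P i))
    ≤⟨ sum-mono-≤ (λ i → ℕP.*-monoʳ-≤ (χ≢0 (c i)) (sparse i)) ⟩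
  ℕΣ.sum (λ i → χ≢0 (c i) ℕ.* t)
    ≡⟨ ≡.sym (ℕΣ.*-distribʳ-sum t (χ≢0 ∘ c)) ⟩
  nonzeros c ℕ.* t
    ≡⟨ ℕP.*-comm (nonzeros c) t ⟩
  t ℕ.* nonzeros c ∎
  where open ℕP.≤-Reasoning

SupportBound : Graph n → ℕ → ℕ → Set
SupportBound {n} G s t = ∀ {k} (D : Fin k → Orientation n) (c : Fin k → ℚ) (α : ℚ) →
                         α ≢ 0ℚ → Represents G D c α → s ≤ t ℕ.* nonzeros c

record WitnessFamily (G : Graph n) (s t : ℕ) : Set where
  field
    point     : Fin s → Assignment n
    PM≢0      : ∀ f → PM G (point f) ≢ 0ℚ
    Pf-sparse : ∀ D → ℕΣ.sum (λ f → χ≢0 (Pf n (skewMatrix G D (point f)))) ≤ t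

supportBound-empty : SupportBound emptyGraph 1 1
supportBound-empty D c α α≢0 rep =
  ℕP.≤-trans (ℕP.n≢0⇒n>0 support≢0) (ℕP.≤-reflexive (≡.sym (ℕP.*-identityˡ (nonzeros c))))
  where
  support≢0 : nonzeros c ≢ 0
  support≢0 none = α≢0 (begin
    α                        ≡⟨ ≡.sym (ℚP.*-identityʳ α) ⟩
    α * 1ℚ                   ≡⟨ rep (λ ()) ⟩
    sumFin (λ i → c i * 1ℚ)  ≡⟨ sumFin≡sum (λ i → c i * 1ℚ) ⟩
    sum (λ i → c i * 1ℚ)     ≡⟨ sum-zero (λ i → trans (cong (_* 1ℚ) (nonzeros≡0 c none i)) (ℚP.*-zeroˡ 1ℚ)) ⟩
    0ℚ                       ∎)
    where open ≡-Reasoning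

supportBound-⊔ : (G : Graph a) (H : Graph b) {s t p q : ℕ} →
                 WitnessFamily G s t → SupportBound H p q → SupportBound (G ⊔ᴳ H) (s ℕ.* p) (t ℕ.* q)
supportBound-⊔ {a} {b} G H {s} {t} {p} {q} W bound {k} D c α α≢0 rep = begin
  s ℕ.* p                                    ≡⟨ ≡.sym (sum-const s p) ⟩
  ℕΣ.sum (λ (f : Fin s) → p)                 ≤⟨ sum-mono-≤ slice-bound ⟩
  ℕΣ.sum (λ f → q ℕ.* nonzeros (slice f))    ≡⟨ ≡.sym (ℕΣ.*-distribˡ-sum q (nonzeros ∘ slice)) ⟩
  q ℕ.* ℕΣ.sum (nonzeros ∘ slice)            ≤⟨ ℕP.*-monoʳ-≤ q (nonzeros-weighted c PfG sparse) ⟩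
  q ℕ.* (t ℕ.* nonzeros c)                   ≡⟨ ≡.sym (ℕP.*-assoc q t (nonzeros c)) ⟩
  q ℕ.* t ℕ.* nonzeros c                     ≡⟨ cong (ℕ._* nonzeros c) (ℕP.*-comm q t) ⟩
  t ℕ.* q ℕ.* nonzeros c ∎
  where
  open ℕP.≤-Reasoning
  open WitnessFamily W
  PfG : Fin k → Fin s → ℚ
  PfG i f = Pf a (skewMatrix G (topLeft b (D i)) (point f))
  slice : Fin s → Fin k → ℚ
  slice f i = c i * PfG i f
  sparse : ∀ i → ℕΣ.sum (χ≢0 ∘ PfG i) ≤ t
  sparse i = Pf-sparse (topLeft b (D i))
  slice-bound : ∀ f → p ≤ q ℕ.* nonzeros (slice f)
  slice-bound f = bound (λ i → bottomRight a (D i)) (slice f) (α * PM G (point f))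
                        (x#0y#0→xy#0 α≢0 (PM≢0 f))
                        (represents-⊔ G H {D = D} {c} {α} rep (point f))

K33-left-side : ∀ (i : Fin 3) → (toℕ (i ↑ˡ 3) <ᵇ 3) ≡ true
K33-left-side zero             = refl
K33-left-side (suc zero)       = refl
K33-left-side (suc (suc zero)) = refl

bipartiteMatchingSum : Assignment 6 → ℚ
bipartiteMatchingSum x = ∑Fun 3 3 (λ F₁ → ∑Fun 3 3 (λ F₂ → matchingTerm K33 x (((3 ↑ʳ_) ∘ F₁) ++ ((_↑ˡ 3) ∘ F₂))))

PM-K33 : ∀ x → PM K33 x ≡ bipartiteMatchingSum x
PM-K33 x = trans (PM-∑Fun K33 x)
  (matchingSum-blocks 3 3 K33 x (↑ʳ-↑ˡ-complementary 3 3) (↑ˡ-↑ʳ-complementary 3 3)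
                      (λ i j → cong₂ _xor_ (K33-left-side i) (K33-left-side j)) (λ i j → refl))

digit : ℕ → ℕ → Bool
digit zero    n = n ℕ.% 2 ≡ᵇ 1
digit (suc k) n = digit k (n ℕ./ 2)

signPoint : Fin 16 → Assignment 6
signPoint f i j = entry (toℕ i) (toℕ j)
  where
  signOf : ℕ → ℚ
  signOf k = if digit k (toℕ f) then - 1ℚ else 1ℚ
  entry : ℕ → ℕ → ℚ
  entry 1 4 = signOf 0
  entry 1 5 = signOf 1
  entry 2 4 = signOf 2
  entry 2 5 = signOf 3
  entry _ _ = 1ℚ

opaque
  unfolding ∑Fun

  bipartiteMatchingSum≢0 : ∀ f → bipartiteMatchingSum (signPoint f) ≢ 0ℚ
  bipartiteMatchingSum≢0 = from-yes (all? (λ f → ¬? (bipartiteMatchingSum (signPoint f) ≟ 0ℚ)))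

K33-PM≢0 : ∀ f → PM K33 (signPoint f) ≢ 0ℚ
K33-PM≢0 f PM≡0 = bipartiteMatchingSum≢0 f (trans (≡.sym (PM-K33 (signPoint f))) PM≡0)

edgeBits : Orientation 6 → Vec Bool 9
edgeBits D = D (# 0) (# 3) ∷ D (# 0) (# 4) ∷ D (# 0) (# 5)
           ∷ D (# 1) (# 3) ∷ D (# 1) (# 4) ∷ D (# 1) (# 5)
           ∷ D (# 2) (# 3) ∷ D (# 2) (# 4) ∷ D (# 2) (# 5) ∷ []

orientationOf : Vec Bool 9 → Orientation 6
orientationOf (b₀₃ ∷ b₀₄ ∷ b₀₅ ∷ b₁₃ ∷ b₁₄ ∷ b₁₅ ∷ b₂₃ ∷ b₂₄ ∷ b₂₅ ∷ []) i j = pick (toℕ i) (toℕ j)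
  where
  pick : ℕ → ℕ → Bool
  pick 0 3 = b₀₃
  pick 0 4 = b₀₄
  pick 0 5 = b₀₅
  pick 1 3 = b₁₃
  pick 1 4 = b₁₄
  pick 1 5 = b₁₅
  pick 2 3 = b₂₃
  pick 2 4 = b₂₄
  pick 2 5 = b₂₅
  pick _ _ = false

-- Only the orientations of the nine edges enter the skew-adjacency matrix, so this holds by computation.
Pf-K33-edgeBits : ∀ D x → Pf 6 (skewMatrix K33 D x) ≡ Pf 6 (skewMatrix K33 (orientationOf (edgeBits D)) x)
Pf-K33-edgeBits D x = refl

allVecs : ∀ n → (Vec Bool n → Bool) → Bool
allVecs zero    P = P []
allVecs (suc n) P = allVecs n (P ∘ (true ∷_)) ∧ allVecs n (P ∘ (false ∷_))

allVecs-sound : ∀ n (P : Vec Bool n → Bool) → T (allVecs n P) → ∀ bs → T (P bs)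
allVecs-sound zero    P holds []           = holds
allVecs-sound (suc n) P holds (true  ∷ bs) = allVecs-sound n _ (proj₁ (Equivalence.to T-∧ holds)) bs
allVecs-sound (suc n) P holds (false ∷ bs) = allVecs-sound n _ (proj₂ (Equivalence.to T-∧ holds)) bs

K33-Pf-sparse : ∀ D → ℕΣ.sum (λ f → χ≢0 (Pf 6 (skewMatrix K33 D (signPoint f)))) ≤ 6
K33-Pf-sparse D = subst (_≤ 6) (≡.sym (pfSupport-edgeBits D))
                        (ℕP.≤ᵇ⇒≤ _ 6 (allVecs-sound 9 (λ bs → pfSupport (orientationOf bs) ≤ᵇ 6) _ (edgeBits D)))
  where
  pfSupport : Orientation 6 → ℕ
  pfSupport D = ℕΣ.sum (λ f → χ≢0 (Pf 6 (skewMatrix K33 D (signPoint f))))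
  pfSupport-edgeBits : ∀ D → pfSupport D ≡ pfSupport (orientationOf (edgeBits D))
  pfSupport-edgeBits D = ℕΣ.sum-cong-≗ (λ f → cong χ≢0 (Pf-K33-edgeBits D (signPoint f)))

K33-witnesses : WitnessFamily K33 16 6
K33-witnesses = record { point = signPoint ; PM≢0 = K33-PM≢0 ; Pf-sparse = K33-Pf-sparse }

supportBound-K33copies : ∀ r → SupportBound (K33copies r) (16 ^ r) (6 ^ r)
supportBound-K33copies zero    = supportBound-empty
supportBound-K33copies (suc r) =
  supportBound-⊔ K33 (K33copies r) {p = 16 ^ r} {q = 6 ^ r} K33-witnesses (supportBound-K33copies r)

ι : ℕ → ℚ
ι n = fromℤ (+ n)

ι-* : ∀ m n → ι m * ι n ≡ ι (m ℕ.* n)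
ι-* m n = trans (cong (_/ 1) (≡.sym (ℤP.pos-* m n)))
                (ℚP.normalize-coprime (Coprimality.sym (Coprimality.1-coprimeTo (m ℕ.* n))))

ι-mono-≤ : m ≤ n → ι m ℚ.≤ ι n
ι-mono-≤ m≤n = ℚ.*≤* (subst₂ ℤ._≤_ (≡.sym (ℤP.*-identityʳ _)) (≡.sym (ℤP.*-identityʳ _)) (ℤ.+≤+ m≤n))

^ℚ-ratio : ∀ {p a b} → p * ι b ≡ ι a → ∀ r → p ^ℚ r * ι (b ^ r) ≡ ι (a ^ r)
^ℚ-ratio             p*b≡a zero    = refl
^ℚ-ratio {p} {a} {b} p*b≡a (suc r) = begin
  p * p ^ℚ r * ι (b ℕ.* b ^ r)     ≡⟨ cong (p * p ^ℚ r *_) (≡.sym (ι-* b (b ^ r))) ⟩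
  p * p ^ℚ r * (ι b * ι (b ^ r))   ≡⟨ interchange p (p ^ℚ r) (ι b) (ι (b ^ r)) ⟩
  p * ι b * (p ^ℚ r * ι (b ^ r))   ≡⟨ cong₂ _*_ p*b≡a (^ℚ-ratio p*b≡a r) ⟩
  ι a * ι (a ^ r)                  ≡⟨ ι-* a (a ^ r) ⟩
  ι (a ℕ.* a ^ r) ∎
  where
  open ≡-Reasoning
  open CommutativeSemigroupProperties (CommutativeRing.*-commutativeSemigroup ℚP.+-*-commutativeRing)
    using (interchange)

ratio⇒≤ι : ∀ {p a b k} → p * ι b ≡ ι a → 0 ℕ.< b → a ≤ b ℕ.* k → p ℚ.≤ ι k
ratio⇒≤ι {p} {a} {suc b} {k} p*b≡a _ a≤bk = ℚP.*-cancelʳ-≤-pos (ι (suc b)) (begin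
  p * ι (suc b)          ≡⟨ p*b≡a ⟩
  ι a                    ≤⟨ ι-mono-≤ a≤bk ⟩
  ι (suc b ℕ.* k)        ≡⟨ ≡.sym (ι-* (suc b) k) ⟩
  ι (suc b) * ι k        ≡⟨ ℚP.*-comm (ι (suc b)) (ι k) ⟩
  ι k * ι (suc b) ∎)
  where open ℚP.≤-Reasoning

ceiling≡ : ∀ p → ceiling p ≡ ℤ.- ((ℤ.- ℚ.↥ p) ℤ./ ℚ.↧ p)
ceiling≡ (mkℚ ℤ.-[1+ _ ] _ _) = refl
ceiling≡ (mkℚ (+ 0)      _ _) = refl
ceiling≡ (mkℚ ℤ.+[1+ _ ] _ _) = refl

-⌊-n/d⌋≤ : ∀ n d k → n ℤ.≤ k ℤ.* + suc d → ℤ.- ((ℤ.- n) ℤ./ + suc d) ℤ.≤ k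
-⌊-n/d⌋≤ n d k n≤kd = begin
  ℤ.- ((ℤ.- n) ℤ./ + suc d)  ≡⟨ cong ℤ.-_ (ℤDivMod.div-pos-is-/ℕ (ℤ.- n) (suc d)) ⟩
  ℤ.- q                       ≤⟨ ℤP.neg-mono-≤ -k≤q ⟩
  ℤ.- (ℤ.- k)                 ≡⟨ ℤP.neg-involutive k ⟩
  k ∎
  where
  open ℤP.≤-Reasoning
  q = (ℤ.- n) ℤ./ℕ suc d
  -k<1+q : ℤ.- k ℤ.< ℤ.suc q
  -k<1+q = ℤP.*-cancelʳ-<-nonNeg (+ suc d) (begin-strict
    ℤ.- k ℤ.* + suc d    ≡⟨ ≡.sym (ℤP.neg-distribˡ-* k (+ suc d)) ⟩
    ℤ.- (k ℤ.* + suc d)  ≤⟨ ℤP.neg-mono-≤ n≤kd ⟩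
    ℤ.- n                <⟨ ℤDivMod.n<s[n/ℕd]*d (ℤ.- n) (suc d) ⟩
    ℤ.suc q ℤ.* + suc d  ∎)
  -k≤q : ℤ.- k ℤ.≤ q
  -k≤q = subst (ℤ.- k ℤ.≤_) (ℤP.pred-suc q) (ℤP.i<j⇒i≤pred[j] -k<1+q)

ceiling-≤ : ∀ p k → p ℚ.≤ ι k → ceiling p ℤ.≤ + k
ceiling-≤ p@(mkℚ n d _) k (ℚ.*≤* n*1≤k*d) =
  subst (ℤ._≤ + k) (≡.sym (ceiling≡ p)) (-⌊-n/d⌋≤ n d (+ k) (subst (ℤ._≤ _) (ℤP.*-identityʳ n) n*1≤k*d))

theorem4p1 : (r : ℕ) → 1 ≤ r →
    PfaffianNumberAtLeast (K33copies r) (ceiling (((+ 8) / 3) ^ℚ r))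
theorem4p1 r _ k _ (D , c , PM≡ΣPf) =
  ceiling-≤ (((+ 8) / 3) ^ℚ r) k (ratio⇒≤ι (^ℚ-ratio {(+ 8) / 3} {16} {6} refl r) (ℕP.m^n>0 6 r) (begin
    16 ^ r               ≤⟨ supportBound-K33copies r D c 1ℚ (λ ()) (λ x → trans (ℚP.*-identityˡ _) (PM≡ΣPf x)) ⟩
    6 ^ r ℕ.* nonzeros c ≤⟨ ℕP.*-monoʳ-≤ (6 ^ r) (nonzeros≤ c) ⟩
    6 ^ r ℕ.* k          ∎))
  where open ℕP.≤-Reasoning
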